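{- Let $\mathcal{A}=\{A_1,\dots,A_r\}$ be a partition of $[n]$ with $|A_i|\ge2$. Suppose $X,Y,Z$ are $\mathcal{A}$-cuts with $\langle X\rangle\supseteq A_i\cup A_j$, $\langle Y\rangle\supseteq A_i\cup A_k$, $\langle Z\rangle\supseteq A_j\cup A_k$ for some distinct $i,j,k\in[r]$. If there is an $\mathcal{A}$-cut $W$ such that $X\sim_{\{i,j\}}W$, $Y\sim_{\{i,k\}}W$, $Z\sim_{\{j,k\}}W$, and none of $X,Y,Z$ satisfies $\cdot\sim_{\{i,j,k\}}W$, then $\{X,Y,Z\}$ is not laminarizable.
   Context: For $X\subseteq[n]$, $\langle X\rangle:=\bigcup\{A_i\in\mathcal{A}:\emptyset\ne X\cap A_i\ne A_i\}$. $X$ is an $\mathcal{A}$-cut if $\langle X\rangle$ contains at least two blocks $A_i$. For nonempty $R\subseteq[r]$, $A_R:=\bigcup_{i\in R}A_i$, $\langle X\rangle_R:=\langle X\rangle\cap A_R$, and for $\mathcal{A}$-cuts $X,Y$: $X\sim_R Y$ iff $\{\langle X\rangle_R\cap X,\ \langle X\rangle_R\setminus X\}=\{\langle Y\rangle_R\cap Y,\ \langle Y\rangle_R\setminus Y\}$. For $\mathcal{A}$-cuts, $X\sim Y$ iff $\{\langle X\rangle\cap X,\langle X\rangle\setminus X\}=\{\langle Y\rangle\cap Y,\langle Y\rangle\setminus Y\}$ (equivalently, the one-member families $\{X\}$ and $\{Y\}$ display the same complete $\mathcal{A}$-partite quartet system); for families $\mathcal{F},\mathcal{G}$ of $\mathcal{A}$-cuts,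 $\mathcal{F}\sim\mathcal{G}$ iff $\{[X]:X\in\mathcal{F}\}=\{[X]:X\in\mathcal{G}\}$ where $[X]$ is the $\sim$-class. A family of $\mathcal{A}$-cuts $\mathcal{F}$ is laminarizable if there is a laminar family $\mathcal{L}$ of $\mathcal{A}$-cuts (any two members nested or disjoint) with $\mathcal{F}\sim\mathcal{L}$. -}

module Defs where

open import Data.Nat using (ℕ; _≤_)
open import Data.Fin using (Fin)
open import Data.Fin.Subset using (Subset; _∈_; _∉_; _⊆_; ⊤)
open import Data.Product using (Σ; ∃; ∃-syntax; _×_; _,_)
open import Data.Sum using (_⊎_)
open import Data.List using (List)
open import Data.List.Relation.Unary.All using (All)
open import Data.List.Relation.Unary.Any using (Any)
open import Relation.Binary.PropositionalEquality using (_≡_; _≢_)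
open import Relation.Nullary using (¬_)

-- A partition 𝒜 = {A_1,…,A_r} of [n] is encoded by the block map
-- blk : Fin n → Fin r  (A_i = { a | blk a ≡ i }).

BlocksAtLeastTwo : ∀ {n r} → (Fin n → Fin r) → Set
BlocksAtLeastTwo {n} {r} blk =
  ∀ (i : Fin r) → ∃[ a ] ∃[ b ] (a ≢ b × blk a ≡ i × blk b ≡ i)

module _ {n r : ℕ} (blk : Fin n → Fin r) where

  Cuts : Subset n → Fin r → Set
  Cuts X i = (∃[ a ] (blk a ≡ i × a ∈ X)) × (∃[ b ] (blk b ≡ i × b ∉ X))

  InAngleR : Subset r → Subset n → Fin n → Set
  InAngleR R X a = blk a ∈ R × Cuts X (blk a)

  InAngle : Subset n → Fin n → Set
  InAngle = InAngleR ⊤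

  ACut : Subset n → Set
  ACut X = ∃[ i ] ∃[ j ] (i ≢ j × Cuts X i × Cuts X j)

  SameSet : (Fin n → Set) → (Fin n → Set) → Set
  SameSet P Q = ∀ a → (P a → Q a) × (Q a → P a)

  UPairEq : (Fin n → Set) → (Fin n → Set) → (Fin n → Set) → (Fin n → Set) → Set
  UPairEq P₁ P₂ Q₁ Q₂ =
    (SameSet P₁ Q₁ × SameSet P₂ Q₂) ⊎ (SameSet P₁ Q₂ × SameSet P₂ Q₁)

  SimR : Subset r → Subset n → Subset n → Set
  SimR R X Y =
    UPairEq (λ a → InAngleR R X a × a ∈ X) (λ a → InAngleR R X a × a ∉ X)
            (λ a → InAngleR R Y a × a ∈ Y) (λ a → InAngleR R Y a × a ∉ Y)

  Sim : Subset n → Subset n → Set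
  Sim X Y =
    UPairEq (λ a → InAngle X a × a ∈ X) (λ a → InAngle X a × a ∉ X)
            (λ a → InAngle Y a × a ∈ Y) (λ a → InAngle Y a × a ∉ Y)

  -- families of 𝒜-cuts are given as (finite) lists; F ∼ G iff they have
  -- the same set of ∼-classes
  FamSim : List (Subset n) → List (Subset n) → Set
  FamSim F G =
    All (λ X → Any (λ Y → Sim X Y) G) F × All (λ Y → Any (λ X → Sim X Y) F) G

  Disjoint : Subset n → Subset n → Set
  Disjoint X Y = ∀ a → ¬ (a ∈ X × a ∈ Y)

  Laminar : List (Subset n) → Set
  Laminar L = All (λ X → All (λ Y → (X ⊆ Y ⊎ Y ⊆ X) ⊎ Disjoint X Y) L) L

  Laminarizable : List (Subset n) → Set
  Laminarizable F = ∃[ L ] (All ACut L × Laminar L × FamSim F L)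

module Submission where

open import Defs
open import Data.Nat using (ℕ)
open import Data.Fin using (Fin)
open import Data.Fin.Subset using (Subset; ⁅_⁆; _∪_)
open import Data.Product using (Σ; ∃; ∃-syntax; _×_; _,_)
open import Data.Sum using (_⊎_)
open import Data.List using (List; _∷_; [])
open import Relation.Binary.PropositionalEquality using (_≡_; _≢_)
open import Relation.Nullary using (¬_)

open import Data.Bool using (Bool; true; false; not; _xor_)
import Data.Bool as Bool
open import Data.Bool.Properties
  using (not-involutive; not-injective; ¬-not; not-¬; xor-assoc; not-distribˡ-xor)
open import Data.Empty using (⊥; ⊥-elim)
open import Data.Fin.Properties using (¬∀⟶∃¬) renaming (_≟_ to _≟ᶠ_)
open import Data.Fin.Subset using (_∈_; _∉_; _⊆_)
open import Data.Fin.Subset.Properties using (∈⊤; x∈⁅x⁆; x∈⁅y⁆⇒x≡y; x∈p∪q⁺; x∈p∪q⁻; _∈?_)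
open import Data.List.Membership.Propositional using (find) renaming (_∈_ to _∈ₗ_)
import Data.List.Relation.Unary.All as All
open import Data.Product using (proj₁; proj₂)
open import Data.Sum using (inj₁; inj₂; [_,_]′; swap; assocˡ; map₂)
import Data.Sum as Sum
open import Data.Vec using (lookup)
open import Data.Vec.Properties using ([]=⇒lookup; lookup⇒[]=)
open import Relation.Binary.PropositionalEquality using (refl; sym; trans; cong; subst; module ≡-Reasoning)
open import Relation.Nullary using (yes; no)
open import Relation.Nullary.Decidable.Core using (_→-dec_)
open import Relation.Unary using (Decidable)

-- Suppose a laminar L satisfies L ∼ {X, Y, Z}, with members
-- X', Y', Z' ∼ X, Y, Z.  Decoding the hypotheses, W cuts the blocks A_i, A_j,
-- A_k; on A_i ∪ A_j the set X' equals W or its complement (a flag), and it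
-- deviates from that choice somewhere in A_k (otherwise X ∼_{i,j,k} W);
-- symmetrically for Y' and Z'.  Two of the three flags agree.  If all three
-- agree, any two of X', Y', Z' meet, hence are nested, and nestedness forces
-- the three deviation points to carry pairwise different values of W.  If
-- the third flag differs, that set crosses the other two, hence is disjoint
-- from both, yet meets one of them at a deviation point.

bool-pigeonhole : ∀ (a b c : Bool) → a ≡ b ⊎ a ≡ c ⊎ b ≡ c
bool-pigeonhole true  true  _     = inj₁ refl
bool-pigeonhole false false _     = inj₁ refl
bool-pigeonhole true  false true  = inj₂ (inj₁ refl)
bool-pigeonhole true  false false = inj₂ (inj₂ refl)
bool-pigeonhole false true  true  = inj₂ (inj₂ refl)
bool-pigeonhole false true  false = inj₂ (inj₁ refl)

three-distinct : ∀ {a b c : Bool} → a ≢ b → a ≢ c → b ≢ c → ⊥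
three-distinct {a} {b} {c} a≢b a≢c b≢c = [ a≢b , [ a≢c , b≢c ]′ ]′ (bool-pigeonhole a b c)

xor-invert : ∀ s {x y} → y ≡ s xor x → x ≡ s xor y
xor-invert true  {x} refl = sym (not-involutive x)
xor-invert false refl = refl

xor-compose : ∀ t s {x y z} → z ≡ t xor y → y ≡ s xor x → z ≡ (t xor s) xor x
xor-compose t s {x} refl refl = sym (xor-assoc t s x)

xor-solve : ∀ t s {x x' w} → x' ≡ t xor x → x' ≡ (t xor s) xor w → w ≡ s xor x
xor-solve true  true  refl eq = sym eq
xor-solve true  false refl eq = sym (not-injective eq)
xor-solve false true  {w = w} refl eq = trans (sym (not-involutive w)) (cong not (sym eq))
xor-solve false false refl eq = sym eq

not-false : ∀ {a b} → a ≡ not b → b ≡ false → a ≡ true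
not-false a≡¬b refl = a≡¬b

smaller-outside : ∀ {a b} → (a ≡ true → b ≡ true) → a ≢ b → a ≡ false
smaller-outside {true}  a⇒b a≢b = ⊥-elim (a≢b (sym (a⇒b refl)))
smaller-outside {false} _   _   = refl

larger-inside : ∀ {a b} → (b ≡ true → a ≡ true) → a ≢ b → a ≡ true
larger-inside {_}     {true}  b⇒a _   = b⇒a refl
larger-inside {true}  {false} _   _   = refl
larger-inside {false} {false} _   a≢b = ⊥-elim (a≢b refl)

module _ {E : Set} where

  _⊕_ : Bool → (E → Bool) → E → Bool
  (g ⊕ w) e = g xor w e

  NestedOrDisjoint : (E → Bool) → (E → Bool) → Set
  NestedOrDisjoint x y =
    ((∀ e → x e ≡ true → y e ≡ true) ⊎ (∀ e → y e ≡ true → x e ≡ true))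
    ⊎ (∀ e → x e ≡ true → y e ≡ true → ⊥)

  NestedOrDisjoint-sym : ∀ {x y} → NestedOrDisjoint x y → NestedOrDisjoint y x
  NestedOrDisjoint-sym = Sum.map swap (λ disjoint e y∋e x∋e → disjoint e x∋e y∋e)

  Bichromatic : (E → Bool) → (E → Set) → Set
  Bichromatic w B = (∃ λ e → B e × w e ≡ true) × (∃ λ e → B e × w e ≡ false)

  Bichromatic-flip : ∀ g {w B} → Bichromatic w B → Bichromatic (g ⊕ w) B
  Bichromatic-flip false bi = bi
  Bichromatic-flip true ((p , Bp , wp) , (q , Bq , wq)) =
    (q , Bq , cong not wq) , (p , Bp , cong not wp)

  Bichromatic-agree : ∀ {w w' B} → (∀ e → B e → w e ≡ w' e) → Bichromatic w B → Bichromatic w' B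
  Bichromatic-agree w≈w' ((p , Bp , wp) , (q , Bq , wq)) =
    (p , Bp , trans (sym (w≈w' p Bp)) wp) , (q , Bq , trans (sym (w≈w' q Bq)) wq)

  record Profile (x w : E → Bool) (B₁ B₂ B₃ : E → Set) : Set where
    field
      agree₁   : ∀ e → B₁ e → x e ≡ w e
      agree₂   : ∀ e → B₂ e → x e ≡ w e
      deviant  : E
      deviant∈ : B₃ deviant
      deviates : x deviant ≢ w deviant

  open Profile

  Profile-swap : ∀ {x w B₁ B₂ B₃} → Profile x w B₁ B₂ B₃ → Profile x w B₂ B₁ B₃
  Profile-swap P = record
    { agree₁ = agree₂ P ; agree₂ = agree₁ P
    ; deviant = deviant P ; deviant∈ = deviant∈ P ; deviates = deviates P }

  Profile-resp : ∀ {x w w' B₁ B₂ B₃} → (∀ e → w e ≡ w' e) →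
    Profile x w B₁ B₂ B₃ → Profile x w' B₁ B₂ B₃
  Profile-resp w≈w' P = record
    { agree₁ = λ e b → trans (agree₁ P e b) (w≈w' e)
    ; agree₂ = λ e b → trans (agree₂ P e b) (w≈w' e)
    ; deviant = deviant P ; deviant∈ = deviant∈ P
    ; deviates = λ eq → deviates P (trans eq (sym (w≈w' (deviant P)))) }

  -- If two nested-or-disjoint sets meet, they are nested, so membership in
  -- x is constant on their symmetric difference.
  symdiff-side : ∀ {x y p e₁ e₂} → NestedOrDisjoint x y →
    x p ≡ true → y p ≡ true → x e₁ ≢ y e₁ → x e₂ ≢ y e₂ → x e₁ ≡ x e₂
  symdiff-side (inj₂ disjoint) xp yp _ _ = ⊥-elim (disjoint _ xp yp)
  symdiff-side (inj₁ (inj₁ x⊆y)) _ _ d₁ d₂ =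
    trans (smaller-outside (x⊆y _) d₁) (sym (smaller-outside (x⊆y _) d₂))
  symdiff-side (inj₁ (inj₂ y⊆x)) _ _ d₁ d₂ =
    trans (larger-inside (y⊆x _) d₁) (sym (larger-inside (y⊆x _) d₂))

  -- Sets following w and its complement on a region where w takes both
  -- values cross, so if they are nested or disjoint they are disjoint.
  complementary-disjoint : ∀ {x y w B} → NestedOrDisjoint x y → Bichromatic w B →
    (∀ e → B e → x e ≡ w e) → (∀ e → B e → y e ≡ not (w e)) →
    ∀ e → x e ≡ true → y e ≡ true → ⊥
  complementary-disjoint (inj₂ disjoint) _ _ _ = disjoint
  complementary-disjoint (inj₁ (inj₁ x⊆y)) ((p , Bp , wp) , _) x≈w y≈¬w _ _ _ =
    not-¬ (x⊆y p (trans (x≈w p Bp) wp)) (trans (y≈¬w p Bp) (cong not wp))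
  complementary-disjoint (inj₁ (inj₂ y⊆x)) (_ , (q , Bq , wq)) x≈w y≈¬w _ _ _ =
    not-¬ (y⊆x q (not-false (y≈¬w q Bq) wq)) (trans (x≈w q Bq) wq)

  deviations-differ : ∀ {x y w C D₁ D₂} (P : Profile x w C D₁ D₂) (Q : Profile y w C D₂ D₁) →
    (∃ λ p → C p × w p ≡ true) → NestedOrDisjoint x y → w (deviant P) ≢ w (deviant Q)
  deviations-differ {x} {y} {w} P Q (p , Cp , wp) nested same = deviates P (begin
      x e₁ ≡⟨ symdiff-side nested (trans (agree₁ P p Cp) wp) (trans (agree₁ Q p Cp) wp) x≢y₁ x≢y₂ ⟩
      x e₂ ≡⟨ agree₂ P e₂ (deviant∈ Q) ⟩
      w e₂ ≡⟨ sym same ⟩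
      w e₁ ∎)
    where
    open ≡-Reasoning
    e₁ e₂ : E
    e₁ = deviant P
    e₂ = deviant Q
    x≢y₁ : x e₁ ≢ y e₁
    x≢y₁ eq = deviates P (trans eq (agree₂ Q e₁ (deviant∈ P)))
    x≢y₂ : x e₂ ≢ y e₂
    x≢y₂ eq = deviates Q (trans (sym eq) (agree₂ P e₂ (deviant∈ Q)))

  -- Case of three equal flags: the deviation points would carry three
  -- pairwise different Booleans.
  triangle-sameFlip : ∀ {x y z w B₁ B₂ B₃} →
    Profile x w B₁ B₂ B₃ → Profile y w B₁ B₃ B₂ → Profile z w B₂ B₃ B₁ →
    (∃ λ p → B₁ p × w p ≡ true) → (∃ λ p → B₂ p × w p ≡ true) → (∃ λ p → B₃ p × w p ≡ true) →
    NestedOrDisjoint x y → NestedOrDisjoint x z → NestedOrDisjoint y z → ⊥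
  triangle-sameFlip X Y Z meet₁ meet₂ meet₃ xy xz yz =
    three-distinct (deviations-differ X Y meet₁ xy)
                   (deviations-differ (Profile-swap X) Z meet₂ xz)
                   (deviations-differ (Profile-swap Y) (Profile-swap Z) meet₃ yz)

  -- Case where z follows the complement: z is disjoint from x and from y,
  -- but meets one of them at a deviation point.
  triangle-oppositeFlip : ∀ {x y z w B₁ B₂ B₃} →
    Profile x w B₁ B₂ B₃ → Profile y w B₁ B₃ B₂ → Profile z (true ⊕ w) B₂ B₃ B₁ →
    (∃ λ p → B₁ p × w p ≡ true) → Bichromatic w B₂ → Bichromatic w B₃ →
    NestedOrDisjoint x y → NestedOrDisjoint x z → NestedOrDisjoint y z → ⊥
  triangle-oppositeFlip {x} {y} {z} {w} X Y Z meet₁ bi₂ bi₃ xy xz yz = meet-at (w (deviant Y)) refl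
    where
    y∩z=∅ : ∀ e → y e ≡ true → z e ≡ true → ⊥
    y∩z=∅ = complementary-disjoint yz bi₃ (agree₂ Y) (agree₂ Z)
    x∩z=∅ : ∀ e → x e ≡ true → z e ≡ true → ⊥
    x∩z=∅ = complementary-disjoint xz bi₂ (agree₂ X) (agree₁ Z)
    meet-at : ∀ b → w (deviant Y) ≡ b → ⊥
    meet-at false wY = y∩z=∅ (deviant Y) (not-false (¬-not (deviates Y)) wY)
                                         (not-false (agree₁ Z _ (deviant∈ Y)) wY)
    meet-at true wY = x∩z=∅ (deviant X) (not-false (¬-not (deviates X)) wX)
                                        (not-false (agree₂ Z _ (deviant∈ X)) wX)
      where
      wX : w (deviant X) ≡ false
      wX = ¬-not (λ eq → deviations-differ X Y meet₁ xy (trans eq (sym wY)))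

  triangle : ∀ {x y z v B₁ B₂ B₃} g h →
    Profile x (g ⊕ v) B₁ B₂ B₃ → Profile y (g ⊕ v) B₁ B₃ B₂ → Profile z (h ⊕ v) B₂ B₃ B₁ →
    Bichromatic v B₁ → Bichromatic v B₂ → Bichromatic v B₃ →
    NestedOrDisjoint x y → NestedOrDisjoint x z → NestedOrDisjoint y z → ⊥
  triangle {z = z} {v} {B₁} {B₂} {B₃} g h X Y Z b₁ b₂ b₃ with h Bool.≟ g
  ... | yes refl = triangle-sameFlip X Y Z
                     (proj₁ (Bichromatic-flip g b₁)) (proj₁ (Bichromatic-flip g b₂)) (proj₁ (Bichromatic-flip g b₃))
  ... | no h≢g = triangle-oppositeFlip X Y Z'
                   (proj₁ (Bichromatic-flip g b₁)) (Bichromatic-flip g b₂) (Bichromatic-flip g b₃)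
    where
    -- h = not g, so z follows the complement of g ⊕ v
    Z' : Profile z (true ⊕ (g ⊕ v)) B₂ B₃ B₁
    Z' = Profile-resp (λ e → sym (not-distribˡ-xor g (v e)))
           (subst (λ h → Profile z (h ⊕ v) B₂ B₃ B₁) (¬-not h≢g) Z)

  no-laminar-triangle : ∀ {x y z v B₁ B₂ B₃} gx gy gz →
    Profile x (gx ⊕ v) B₁ B₂ B₃ → Profile y (gy ⊕ v) B₁ B₃ B₂ → Profile z (gz ⊕ v) B₂ B₃ B₁ →
    Bichromatic v B₁ → Bichromatic v B₂ → Bichromatic v B₃ →
    NestedOrDisjoint x y → NestedOrDisjoint x z → NestedOrDisjoint y z → ⊥
  no-laminar-triangle gx gy gz X Y Z b₁ b₂ b₃ xy xz yz with bool-pigeonhole gx gy gz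
  ... | inj₁ refl = triangle gx gz X Y Z b₁ b₂ b₃ xy xz yz
  ... | inj₂ (inj₁ refl) =
    triangle gx gy (Profile-swap X) Z Y b₂ b₁ b₃ xz xy (NestedOrDisjoint-sym yz)
  ... | inj₂ (inj₂ refl) =
    triangle gy gx (Profile-swap Y) (Profile-swap Z) X b₃ b₁ b₂
      yz (NestedOrDisjoint-sym xy) (NestedOrDisjoint-sym xz)

module _ {n : ℕ} where

  χ : Subset n → Fin n → Bool
  χ X = lookup X

  ∈⇒χ : ∀ {X e} → e ∈ X → χ X e ≡ true
  ∈⇒χ = []=⇒lookup

  χ⇒∈ : ∀ {X e} → χ X e ≡ true → e ∈ X
  χ⇒∈ {X} {e} = lookup⇒[]= e X

  ∉⇒χ : ∀ {X e} → e ∉ X → χ X e ≡ false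
  ∉⇒χ e∉X = ¬-not (λ eq → e∉X (χ⇒∈ eq))

  χ⇒∉ : ∀ {X e} → χ X e ≡ false → e ∉ X
  χ⇒∉ eq e∈X = not-¬ (∈⇒χ e∈X) eq

  χ-agree : ∀ {X Y e} → (e ∈ X → e ∈ Y) → (e ∉ X → e ∉ Y) → χ Y e ≡ χ X e
  χ-agree {X} {e = e} in⇒in out⇒out with e ∈? X
  ... | yes e∈X = trans (∈⇒χ (in⇒in e∈X)) (sym (∈⇒χ e∈X))
  ... | no  e∉X = trans (∉⇒χ (out⇒out e∉X)) (sym (∉⇒χ e∉X))

  χ-complement : ∀ {X Y e} → (e ∈ X → e ∉ Y) → (e ∉ X → e ∈ Y) → χ Y e ≡ not (χ X e)
  χ-complement {X} {e = e} in⇒out out⇒in with e ∈? X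
  ... | yes e∈X = trans (∉⇒χ (in⇒out e∈X)) (cong not (sym (∈⇒χ e∈X)))
  ... | no  e∉X = trans (∈⇒χ (out⇒in e∉X)) (cong not (sym (∉⇒χ e∉X)))

  ∈-transport : ∀ {X Y e} → χ X e ≡ χ Y e → e ∈ X → e ∈ Y
  ∈-transport eq e∈X = χ⇒∈ (trans (sym eq) (∈⇒χ e∈X))

  ∉-transport : ∀ {X Y e} → χ X e ≡ χ Y e → e ∉ X → e ∉ Y
  ∉-transport eq e∉X = χ⇒∉ (trans (sym eq) (∉⇒χ e∉X))

  ∈-complement : ∀ {X Y e} → χ Y e ≡ not (χ X e) → e ∈ X → e ∉ Y
  ∈-complement eq e∈X = χ⇒∉ (trans eq (cong not (∈⇒χ e∈X)))

  ∉-complement : ∀ {X Y e} → χ Y e ≡ not (χ X e) → e ∉ X → e ∈ Y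
  ∉-complement eq e∉X = χ⇒∈ (trans eq (cong not (∉⇒χ e∉X)))

  covered : ∀ (X : Subset n) {A B Q₁ Q₂ : Fin n → Set} →
    (∀ e → A e × e ∈ X → B e × Q₁ e) → (∀ e → A e × e ∉ X → B e × Q₂ e) → ∀ e → A e → B e
  covered X inside outside e Ae with e ∈? X
  ... | yes e∈X = proj₁ (inside e (Ae , e∈X))
  ... | no  e∉X = proj₁ (outside e (Ae , e∉X))

  counterexample : ∀ {B P : Fin n → Set} → Decidable B → Decidable P →
    ¬ (∀ e → B e → P e) → ∃ λ e → B e × ¬ P e
  counterexample {B} {P} B? P? ¬all with ¬∀⟶∃¬ n (λ e → B e → P e) (λ e → B? e →-dec P? e) ¬all
  ... | e , ¬B⇒P with B? e
  ...   | yes Be = e , Be , (λ Pe → ¬B⇒P (λ _ → Pe))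
  ...   | no ¬Be = ⊥-elim (¬B⇒P (λ Be → ⊥-elim (¬Be Be)))

module _ {n r : ℕ} (blk : Fin n → Fin r) where

  InBlock : Fin r → Fin n → Set
  InBlock c e = blk e ≡ c

  cuts⇒bichromatic : ∀ {X c} → Cuts blk X c → Bichromatic (χ X) (InBlock c)
  cuts⇒bichromatic ((a , ba , a∈X) , (b , bb , b∉X)) = (a , ba , ∈⇒χ a∈X) , (b , bb , ∉⇒χ b∉X)

  bichromatic⇒cuts : ∀ {X c} → Bichromatic (χ X) (InBlock c) → Cuts blk X c
  bichromatic⇒cuts ((a , ba , Xa) , (b , bb , Xb)) = (a , ba , χ⇒∈ Xa) , (b , bb , χ⇒∉ Xb)

  cuts-follow : ∀ {W Y c} g → Cuts blk W c →
    (∀ e → blk e ≡ c → χ Y e ≡ g xor χ W e) → Cuts blk Y c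
  cuts-follow g cut follows =
    bichromatic⇒cuts (Bichromatic-agree (λ e b → sym (follows e b))
                        (Bichromatic-flip g (cuts⇒bichromatic cut)))

  -- Decoded form of {A ∩ X, A ∖ X} = {B ∩ Y, B ∖ Y}: the regions coincide
  -- and on them Y is X or its complement.
  record SameBipartition (A B : Fin n → Set) (X Y : Subset n) : Set where
    field
      forward  : ∀ e → A e → B e
      backward : ∀ e → B e → A e
      flip     : Bool
      agree    : ∀ e → A e → χ Y e ≡ flip xor χ X e

  pairEq⇒bipartition : ∀ {A B X Y} →
    UPairEq blk (λ e → A e × e ∈ X) (λ e → A e × e ∉ X) (λ e → B e × e ∈ Y) (λ e → B e × e ∉ Y) →
    SameBipartition A B X Y
  pairEq⇒bipartition {X = X} {Y} (inj₁ (S₁ , S₂)) = record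
    { forward  = covered X (λ e → proj₁ (S₁ e)) (λ e → proj₁ (S₂ e))
    ; backward = covered Y (λ e → proj₂ (S₁ e)) (λ e → proj₂ (S₂ e))
    ; flip     = false
    ; agree    = λ e Ae → χ-agree (λ m → proj₂ (proj₁ (S₁ e) (Ae , m)))
                                  (λ m → proj₂ (proj₁ (S₂ e) (Ae , m))) }
  pairEq⇒bipartition {X = X} {Y} (inj₂ (S₁ , S₂)) = record
    { forward  = covered X (λ e → proj₁ (S₁ e)) (λ e → proj₁ (S₂ e))
    ; backward = covered Y (λ e → proj₂ (S₂ e)) (λ e → proj₂ (S₁ e))
    ; flip     = true
    ; agree    = λ e Ae → χ-complement (λ m → proj₂ (proj₁ (S₁ e) (Ae , m)))
                                       (λ m → proj₂ (proj₁ (S₂ e) (Ae , m))) }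

  match-sides : ∀ {A B P Q : Fin n → Set} → (∀ e → A e → B e) → (∀ e → B e → A e) →
    (∀ e → A e → P e → Q e) → (∀ e → A e → Q e → P e) →
    SameSet blk (λ e → A e × P e) (λ e → B e × Q e)
  match-sides A⇒B B⇒A P⇒Q Q⇒P e =
    (λ (Ae , Pe) → A⇒B e Ae , P⇒Q e Ae Pe) ,
    (λ (Be , Qe) → B⇒A e Be , Q⇒P e (B⇒A e Be) Qe)

  bipartition⇒pairEq : ∀ {A B X Y} → SameBipartition A B X Y →
    UPairEq blk (λ e → A e × e ∈ X) (λ e → A e × e ∉ X) (λ e → B e × e ∈ Y) (λ e → B e × e ∉ Y)
  bipartition⇒pairEq record { forward = A⇒B ; backward = B⇒A ; flip = false ; agree = agree } =
    inj₁ ( match-sides A⇒B B⇒A (λ e Ae → ∈-transport (sym (agree e Ae))) (λ e Ae → ∈-transport (agree e Ae))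
         , match-sides A⇒B B⇒A (λ e Ae → ∉-transport (sym (agree e Ae))) (λ e Ae → ∉-transport (agree e Ae)) )
  bipartition⇒pairEq record { forward = A⇒B ; backward = B⇒A ; flip = true ; agree = agree } =
    inj₂ ( match-sides A⇒B B⇒A (λ e Ae → ∈-complement (agree e Ae))
                               (λ e Ae → ∉-complement (xor-invert true (agree e Ae)))
         , match-sides A⇒B B⇒A (λ e Ae → ∉-complement (agree e Ae))
                               (λ e Ae → ∈-complement (xor-invert true (agree e Ae))) )

  simR-cuts : ∀ {R X W u} → (∃ λ a → blk a ≡ u) → (∀ a → blk a ≡ u → InAngle blk X a) →
    u ∈ R → SimR blk R X W → Cuts blk W u
  simR-cuts (a , refl) inAngle u∈R X∼W =
    proj₂ (SameBipartition.forward (pairEq⇒bipartition X∼W) a (u∈R , proj₂ (inAngle a refl)))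

  profileOf : ∀ {X X' W : Subset n} {R₂ R₃ : Subset r} {u v t : Fin r} →
    u ∈ R₂ → v ∈ R₂ → (∀ {c} → c ∈ R₃ → (c ≡ u ⊎ c ≡ v) ⊎ c ≡ t) →
    (∀ a → blk a ≡ u ⊎ blk a ≡ v → InAngle blk X a) →
    Sim blk X X' → SimR blk R₂ X W → ¬ SimR blk R₃ X W → Cuts blk W t →
    Σ Bool λ g → Profile (χ X') (g ⊕ χ W) (InBlock u) (InBlock v) (InBlock t)
  profileOf {X} {X'} {W} {R₂} {R₃} {u} {v} {t} u∈R₂ v∈R₂ R₃⊆ inAngle X∼X' X∼W X≁W W-cuts-t =
    g , record
      { agree₁ = λ e b → follows e (inj₁ b) ; agree₂ = λ e b → follows e (inj₂ b)
      ; deviant = proj₁ deviation ; deviant∈ = proj₁ (proj₂ deviation)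
      ; deviates = proj₂ (proj₂ deviation) }
    where
    module XX' = SameBipartition (pairEq⇒bipartition X∼X')
    module XW  = SameBipartition (pairEq⇒bipartition X∼W)

    g : Bool
    g = XX'.flip xor XW.flip

    inAngle₂ : ∀ {e} → blk e ≡ u ⊎ blk e ≡ v → InAngleR blk R₂ X e
    inAngle₂ {e} (inj₁ b) = subst (_∈ R₂) (sym b) u∈R₂ , proj₂ (inAngle e (inj₁ b))
    inAngle₂ {e} (inj₂ b) = subst (_∈ R₂) (sym b) v∈R₂ , proj₂ (inAngle e (inj₂ b))

    follows : ∀ e → blk e ≡ u ⊎ blk e ≡ v → χ X' e ≡ g xor χ W e
    follows e b = xor-compose XX'.flip XW.flip (XX'.agree e (∈⊤ , proj₂ (inAngle e b)))
                    (xor-invert XW.flip (XW.agree e (inAngle₂ b)))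

    follows-on-t⇒sim : (∀ e → blk e ≡ t → χ X' e ≡ g xor χ W e) → SimR blk R₃ X W
    follows-on-t⇒sim follows-t = bipartition⇒pairEq (record
        { forward = λ e (m , _) → m , [ (λ b → proj₂ (XW.forward e (inAngle₂ b)))
                                      , (λ b → subst (Cuts blk W) (sym b) W-cuts-t) ]′ (R₃⊆ m)
        ; backward = λ e (m , _) → m , [ (λ b → proj₂ (inAngle e b))
                                       , (λ b → X-cuts e b) ]′ (R₃⊆ m)
        ; flip = XW.flip
        ; agree = λ e (m , cut) → [ (λ b → XW.agree e (inAngle₂ b))
                                  , (λ b → xor-solve XX'.flip XW.flip (XX'.agree e (∈⊤ , cut)) (follows-t e b))
                                  ]′ (R₃⊆ m) })
      where
      X-cuts : ∀ e → blk e ≡ t → Cuts blk X (blk e)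
      X-cuts e b = proj₂ (XX'.backward e (∈⊤ , subst (Cuts blk X') (sym b) (cuts-follow g W-cuts-t follows-t)))

    deviation : ∃ λ e → blk e ≡ t × χ X' e ≢ g xor χ W e
    deviation = counterexample (λ e → blk e ≟ᶠ t) (λ e → χ X' e Bool.≟ g xor χ W e)
                               (λ follows-t → X≁W (follows-on-t⇒sim follows-t))

  laminar-pair : ∀ {L A B} → Laminar blk L → A ∈ₗ L → B ∈ₗ L → NestedOrDisjoint (χ A) (χ B)
  laminar-pair laminar A∈L B∈L =
    Sum.map (Sum.map ⊆⇒χ ⊆⇒χ) (λ disjoint e a b → disjoint e (χ⇒∈ a , χ⇒∈ b))
      (All.lookup (All.lookup laminar A∈L) B∈L)
    where
    ⊆⇒χ : ∀ {A B : Subset n} → A ⊆ B → ∀ e → χ A e ≡ true → χ B e ≡ true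
    ⊆⇒χ A⊆B e Ae = ∈⇒χ (A⊆B (χ⇒∈ Ae))

∈-pairˡ : ∀ {r} {a b : Fin r} → a ∈ ⁅ a ⁆ ∪ ⁅ b ⁆
∈-pairˡ {a = a} = x∈p∪q⁺ (inj₁ (x∈⁅x⁆ a))

∈-pairʳ : ∀ {r} {a b : Fin r} → b ∈ ⁅ a ⁆ ∪ ⁅ b ⁆
∈-pairʳ {b = b} = x∈p∪q⁺ (inj₂ (x∈⁅x⁆ b))

∈-triple : ∀ {r} {a b c d : Fin r} → d ∈ ⁅ a ⁆ ∪ ⁅ b ⁆ ∪ ⁅ c ⁆ → d ≡ a ⊎ d ≡ b ⊎ d ≡ c
∈-triple {a = a} {b} {c} m =
  Sum.map (x∈⁅y⁆⇒x≡y a) (λ m' → Sum.map (x∈⁅y⁆⇒x≡y b) (x∈⁅y⁆⇒x≡y c) (x∈p∪q⁻ ⁅ b ⁆ ⁅ c ⁆ m'))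
    (x∈p∪q⁻ ⁅ a ⁆ (⁅ b ⁆ ∪ ⁅ c ⁆) m)

lemma2p7 : ∀ {n r : ℕ} (blk : Fin n → Fin r) → BlocksAtLeastTwo blk →
    (X Y Z : Subset n) → ACut blk X → ACut blk Y → ACut blk Z →
    (i j k : Fin r) → i ≢ j → i ≢ k → j ≢ k →
    (∀ a → (blk a ≡ i ⊎ blk a ≡ j) → InAngle blk X a) →
    (∀ a → (blk a ≡ i ⊎ blk a ≡ k) → InAngle blk Y a) →
    (∀ a → (blk a ≡ j ⊎ blk a ≡ k) → InAngle blk Z a) →
    (W : Subset n) → ACut blk W →
    SimR blk (⁅ i ⁆ ∪ ⁅ j ⁆) X W →
    SimR blk (⁅ i ⁆ ∪ ⁅ k ⁆) Y W →
    SimR blk (⁅ j ⁆ ∪ ⁅ k ⁆) Z W →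
    ¬ SimR blk (⁅ i ⁆ ∪ ⁅ j ⁆ ∪ ⁅ k ⁆) X W →
    ¬ SimR blk (⁅ i ⁆ ∪ ⁅ j ⁆ ∪ ⁅ k ⁆) Y W →
    ¬ SimR blk (⁅ i ⁆ ∪ ⁅ j ⁆ ∪ ⁅ k ⁆) Z W →
    ¬ Laminarizable blk (X ∷ Y ∷ Z ∷ [])
lemma2p7 blk twoEach X Y Z _ _ _ i j k _ _ _ X⊇ Y⊇ Z⊇ W _ X∼W Y∼W Z∼W X≁W Y≁W Z≁W
  (L , _ , laminar , (X~ All.∷ Y~ All.∷ Z~ All.∷ All.[]) , _) =
  let (X' , X'∈L , X∼X') = find X~
      (Y' , Y'∈L , Y∼Y') = find Y~
      (Z' , Z'∈L , Z∼Z') = find Z~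
      W-cuts-i = simR-cuts blk (inhabited i) (λ a b → X⊇ a (inj₁ b)) ∈-pairˡ X∼W
      W-cuts-j = simR-cuts blk (inhabited j) (λ a b → X⊇ a (inj₂ b)) ∈-pairʳ X∼W
      W-cuts-k = simR-cuts blk (inhabited k) (λ a b → Y⊇ a (inj₂ b)) ∈-pairʳ Y∼W
      (gX , PX) = profileOf blk ∈-pairˡ ∈-pairʳ (λ m → assocˡ (∈-triple m))
                    X⊇ X∼X' X∼W X≁W W-cuts-k
      (gY , PY) = profileOf blk ∈-pairˡ ∈-pairʳ (λ m → assocˡ (map₂ swap (∈-triple m)))
                    Y⊇ Y∼Y' Y∼W Y≁W W-cuts-j
      (gZ , PZ) = profileOf blk ∈-pairˡ ∈-pairʳ (λ m → swap (∈-triple m))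
                    Z⊇ Z∼Z' Z∼W Z≁W W-cuts-i
  in no-laminar-triangle gX gY gZ PX PY PZ
       (cuts⇒bichromatic blk W-cuts-i) (cuts⇒bichromatic blk W-cuts-j) (cuts⇒bichromatic blk W-cuts-k)
       (nested X'∈L Y'∈L) (nested X'∈L Z'∈L) (nested Y'∈L Z'∈L)
  where
  inhabited : ∀ c → ∃ λ a → blk a ≡ c
  inhabited c = let (a , _ , _ , a∈c , _) = twoEach c in a , a∈c
  nested : ∀ {A B} → A ∈ₗ L → B ∈ₗ L → NestedOrDisjoint (χ A) (χ B)
  nested = laminar-pair blk laminar
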